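{- Let $\epsilon=2\times 10^{ -8}$, $\delta=2\times 10^{ -6}$, $s=2\times 10^{ -4}$, $d\ge1/\epsilon$ an integer, $G=(V,E)$ a graph, $K=(V,E_K)$ an $(\epsilon,d)$-kernel of $G$ with $\mu(G)\ge(2-\delta)\mu(K)$, fix $i\in\{1,\dots,1/\epsilon\}$, let $M$ be a maximum matching of $K$ leaving at most $7s\mu(K)$ nodes of $V_H$ unmatched, and $M^*$ a maximum matching of $G$. Let $M_H$ and $M_{SH}$ be $(3/2+\epsilon)$-approximate matchings in $G[V_H,V_L]$ and $G[V_{SH},V_L]$, and let $A(M_H)$, $A(M_{SH})$ be the maximum numbers of node-disjoint augmenting paths w.r.t. $M$ in $E_K\cup M_H$ and $E_K\cup M_{SH}$ respectively. Let $n_j$ ($j\in\{1,2,3,4\}$) be the number of frequent length-three augmenting paths in $M\cup M^*$ of type $j$, $n_f=n_1+n_2+n_3+n_4$, and let $b$ be the number of bad nodes. Then $A(M_H)\ge |M_H|-b-n_f$ and $A(M_{SH})\ge |M_{SH}|-b-(n_1+n_2)$.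
   Context: $\mu(\cdot)$ is maximum matching size; $d_K(v)$ degree in $K$. An $(\epsilon,d)$-kernel of $G=(V,E)$ is a subgraph $K=(V,E_K)$, $E_K\subseteq E$, with (P1) $d_K(v)\le d$ for all $v$ and (P2) every $e\in E\setminus E_K$ has an endpoint of $K$-degree at least $d(1-\epsilon)$. Degree classes for the fixed $i$: $V_{SH}=\{v: d_K(v)\ge d(1-\epsilon-i\epsilon^2)\}$, $V_H=\{v: d_K(v)\ge d(1-2s-i\epsilon^2)\}$, $V_M=\{v: d(s+i\epsilon^2)<d_K(v)<d(1-2s-i\epsilon^2)\}$, $V_L=\{v: d_K(v)\le d(s+i\epsilon^2)\}$. $G[A,B]$ is the bipartite subgraph of edges between $A$ and $B$; a matching is $\beta$-approximate in $H$ if its size is at least $\mu(H)/\beta$. A length-three augmenting path in $M\cup M^*$ is a connected component of $M\oplus M^*$ which is a path $v_1-v_2-v_3-v_4$ with $(v_2,v_3)\in M$, $(v_1,v_2),(v_3,v_4)\in M^*$, $v_1,v_4$ unmatched by $M$, labeled so that $e_3=(v_3,v_4)\notin E_K$ (with $e_1=(v_1,v_2)$). It is frequent of type 1 if $(v_1,v_2,v_3,v_4)\in V_L\times V_{SH}\times V_{SH}\times V_L$; type 2 if it lies in $V_L\times(V_H\setminus V_{SH})\times V_{SH}\times V_L$ and $e_1\in E_K$; type 3 if in $V_M\times(V_H\setminus V_{SH})\times V_{SH}\times V_L$ and $e_1\in E_K$; type 4 if in $V_M\times V_M\times V_{SH}\times V_L$ and $e_1\in E_K$. A node is bad if it is matched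 by $M$ and does not lie on a frequent length-three augmenting path. The assumption $\mu(G)\ge(2-\delta)\mu(K)$ is a standing assumption of the section. -}

module Defs where

open import Data.Bool using (Bool; true; false; _∧_; _∨_; not; if_then_else_)
open import Data.Nat as ℕ using (ℕ; zero; suc; _<ᵇ_; _≡ᵇ_)
open import Data.Fin using (Fin; toℕ) renaming (zero to fzero; suc to fsuc)
open import Data.Integer using (+_)
open import Data.Rational using (ℚ; _/_; _+_; _-_; _*_; _≤_; _<_)
open import Data.Rational.Properties using (_≤?_; _<?_)
open import Data.List using (List; []; _∷_; _∷ʳ_; length; head; last)
open import Data.List.Membership.Propositional using (_∈_)
open import Data.List.Relation.Unary.All using (All)
open import Data.List.Relation.Unary.AllPairs using (AllPairs)
open import Data.List.Relation.Unary.Unique.Propositional using (Unique)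
open import Data.Maybe using (just)
open import Data.Product using (Σ; ∃; _×_; _,_)
open import Data.Sum using (_⊎_)
open import Data.Empty using (⊥)
open import Function.Bundles using (_⇔_)
open import Relation.Nullary using (¬_; does)
open import Relation.Binary.PropositionalEquality using (_≡_)

⟦_⟧ : ℕ → ℚ
⟦ k ⟧ = + k / 1

ε : ℚ
ε = + 1 / 50000000

δ : ℚ
δ = + 1 / 500000

s : ℚ
s = + 1 / 5000

β : ℚ
β = + 3 / 2 + ε

sumFin : ∀ {n} → (Fin n → ℕ) → ℕ
sumFin {zero}  f = 0
sumFin {suc n} f = f fzero ℕ.+ sumFin (λ k → f (fsuc k))

numTrue : ∀ {n} → (Fin n → Bool) → ℕ
numTrue f = sumFin (λ k → if f k then 1 else 0)

Graph : ℕ → Set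
Graph n = Fin n → Fin n → Bool

Adj : ∀ {n} → Graph n → Fin n → Fin n → Set
Adj H u v = H u v ≡ true

IsGraph : ∀ {n} → Graph n → Set
IsGraph H = (∀ u v → H u v ≡ H v u) × (∀ u → H u u ≡ false)

_⊆ₑ_ : ∀ {n} → Graph n → Graph n → Set
H ⊆ₑ H' = ∀ u v → Adj H u v → Adj H' u v

_∪ₑ_ : ∀ {n} → Graph n → Graph n → Graph n
(H ∪ₑ H') u v = H u v ∨ H' u v

deg : ∀ {n} → Graph n → Fin n → ℕ
deg H v = numTrue (H v)

-- number of edges (unordered pairs {u,w}, counted once via toℕ u < toℕ w)
size : ∀ {n} → Graph n → ℕ
size H = sumFin (λ u → numTrue (λ w → (toℕ u <ᵇ toℕ w) ∧ H u w))

bip : ∀ {n} → Graph n → (Fin n → Bool) → (Fin n → Bool) → Graph n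
bip G A B u v = G u v ∧ ((A u ∧ B v) ∨ (B u ∧ A v))

IsMatching : ∀ {n} → Graph n → Graph n → Set
IsMatching H M = IsGraph M × (M ⊆ₑ H) × (∀ v → deg M v ℕ.≤ 1)

IsMaximumMatching : ∀ {n} → Graph n → Graph n → Set
IsMaximumMatching H M =
  IsMatching H M × (∀ M' → IsMatching H M' → size M' ℕ.≤ size M)

-- M is a b-approximate matching in H:  |M| ≥ μ(H)/b,
-- i.e. every matching M' of H has |M'| ≤ b·|M|
IsApproxMatching : ∀ {n} → ℚ → Graph n → Graph n → Set
IsApproxMatching b H M =
  IsMatching H M × (∀ M' → IsMatching H M' → ⟦ size M' ⟧ ≤ b * ⟦ size M ⟧)

Matched : ∀ {n} → Graph n → Fin n → Set
Matched M v = ∃ λ w → Adj M v w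

Unmatched : ∀ {n} → Graph n → Fin n → Set
Unmatched M v = ¬ Matched M v

IsKernel : ∀ {n} → ℚ → ℕ → Graph n → Graph n → Set
IsKernel e d G K =
  IsGraph K × (K ⊆ₑ G) ×
  (∀ v → deg K v ℕ.≤ d) ×
  (∀ u v → Adj G u v → ¬ Adj K u v →
     (⟦ d ⟧ * (⟦ 1 ⟧ - e) ≤ ⟦ deg K u ⟧) ⊎ (⟦ d ⟧ * (⟦ 1 ⟧ - e) ≤ ⟦ deg K v ⟧))

module Classes {n : ℕ} (d i : ℕ) (K : Graph n) where

  ε² : ℚ
  ε² = ε * ε

  iε² : ℚ
  iε² = ⟦ i ⟧ * ε²

  dk : Fin n → ℚ
  dk v = ⟦ deg K v ⟧

  inSH : Fin n → Bool
  inSH v = does (⟦ d ⟧ * (⟦ 1 ⟧ - ε - iε²) ≤? dk v)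

  inH : Fin n → Bool
  inH v = does (⟦ d ⟧ * (⟦ 1 ⟧ - ⟦ 2 ⟧ * s - iε²) ≤? dk v)

  inM : Fin n → Bool
  inM v = does (⟦ d ⟧ * (s + iε²) <? dk v) ∧ does (dk v <? ⟦ d ⟧ * (⟦ 1 ⟧ - ⟦ 2 ⟧ * s - iε²))

  inL : Fin n → Bool
  inL v = does (dk v ≤? ⟦ d ⟧ * (s + iε²))

  inHnotSH : Fin n → Bool
  inHnotSH v = inH v ∧ not (inSH v)

  SH H M' L : Fin n → Set
  SH v = inSH v ≡ true
  H v = inH v ≡ true
  M' v = inM v ≡ true
  L v = inL v ≡ true

  HnotSH : Fin n → Set
  HnotSH v = inHnotSH v ≡ true

mutual
  data AltFree {n} (H M : Graph n) : List (Fin n) → Set where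
    one  : ∀ {u v} → Adj H u v → ¬ Adj M u v → AltFree H M (u ∷ v ∷ [])
    more : ∀ {u v w rest} → Adj H u v → ¬ Adj M u v →
           AltMatched H M (v ∷ w ∷ rest) → AltFree H M (u ∷ v ∷ w ∷ rest)

  data AltMatched {n} (H M : Graph n) : List (Fin n) → Set where
    step : ∀ {u v rest} → Adj H u v → Adj M u v →
           AltFree H M (v ∷ rest) → AltMatched H M (u ∷ v ∷ rest)

record AugPath {n} (H M : Graph n) (vs : List (Fin n)) : Set where
  field
    alternating : AltFree H M vs
    simple      : Unique vs
    startFree   : ∀ u → head vs ≡ just u → Unmatched M u
    endFree     : ∀ u → last vs ≡ just u → Unmatched M u

Disjoint : ∀ {n} → List (Fin n) → List (Fin n) → Set
Disjoint xs ys = ∀ x → x ∈ xs → ¬ (x ∈ ys)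

DisjointAugFamily : ∀ {n} → Graph n → Graph n → List (List (Fin n)) → Set
DisjointAugFamily H M ps = All (AugPath H M) ps × AllPairs Disjoint ps

IsMaxNumDisjointAug : ∀ {n} → Graph n → Graph n → ℕ → Set
IsMaxNumDisjointAug {n} H M a =
  (Σ (List (List (Fin n))) λ ps → DisjointAugFamily H M ps × length ps ≡ a) ×
  (∀ ps → DisjointAugFamily H M ps → length ps ℕ.≤ a)

Card : {A : Set} → (A → Set) → ℕ → Set
Card {A} P k =
  Σ (List A) λ xs → Unique xs × (∀ x → (x ∈ xs) ⇔ P x) × length xs ≡ k

module Frequent {n : ℕ} (d i : ℕ) (K M M* : Graph n) where
  open Classes d i K

  -- v₁ - v₂ - v₃ - v₄ with (v₂,v₃) ∈ M, (v₁,v₂),(v₃,v₄) ∈ M*, v₁, v₄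
  -- unmatched by M.  (For matchings M, M* such a path is automatically a
  -- whole connected component of M ⊕ M*.)
  LengthThree : Fin n → Fin n → Fin n → Fin n → Set
  LengthThree v₁ v₂ v₃ v₄ =
    Adj M* v₁ v₂ × Adj M v₂ v₃ × Adj M* v₃ v₄ × Unmatched M v₁ × Unmatched M v₄

  TypeCond : ℕ → Fin n → Fin n → Fin n → Fin n → Set
  TypeCond 1 v₁ v₂ v₃ v₄ = L v₁ × SH v₂ × SH v₃ × L v₄
  TypeCond 2 v₁ v₂ v₃ v₄ = L v₁ × HnotSH v₂ × SH v₃ × L v₄ × Adj K v₁ v₂
  TypeCond 3 v₁ v₂ v₃ v₄ = M' v₁ × HnotSH v₂ × SH v₃ × L v₄ × Adj K v₁ v₂
  TypeCond 4 v₁ v₂ v₃ v₄ = M' v₁ × M' v₂ × SH v₃ × L v₄ × Adj K v₁ v₂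
  TypeCond _ v₁ v₂ v₃ v₄ = ⊥

  FreqLabeled : ℕ → Fin n → Fin n → Fin n → Fin n → Set
  FreqLabeled j v₁ v₂ v₃ v₄ =
    LengthThree v₁ v₂ v₃ v₄ × ¬ Adj K v₃ v₄ × TypeCond j v₁ v₂ v₃ v₄

  -- A length-three path (a component of M ⊕ M*) is identified by its
  -- middle M-edge, as an unordered pair {u,w} written with toℕ u < toℕ w.
  FreqPath : ℕ → Fin n × Fin n → Set
  FreqPath j (u , w) = toℕ u ℕ.< toℕ w ×
    ∃ λ v₁ → ∃ λ v₄ → FreqLabeled j v₁ u w v₄ ⊎ FreqLabeled j v₁ w u v₄

  OnFrequent : Fin n → Set
  OnFrequent v = ∃ λ j → ∃ λ v₁ → ∃ λ v₂ → ∃ λ v₃ → ∃ λ v₄ →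
    FreqLabeled j v₁ v₂ v₃ v₄ ×
    (v ≡ v₁ ⊎ v ≡ v₂ ⊎ v ≡ v₃ ⊎ v ≡ v₄)

  Bad : Fin n → Set
  Bad v = Matched M v × ¬ OnFrequent v

numUnmatchedIn : ∀ {n} → (Fin n → Bool) → Graph n → ℕ
numUnmatchedIn A M = numTrue (λ v → A v ∧ (deg M v ≡ᵇ 0))

-- Let F be a matching in G[hi, V_L], where hi is V_H or V_SH.  Every edge {h, l} of F, with h high
-- and l low, is charged to an augmenting path of K ∪ F, to a bad node, or to a frequent path: if l is
-- matched by M it is bad; if h is free, h – l is augmenting; if h is bad it is charged.  Otherwise h is
-- matched to m and lies on a frequent path, whose middle edge must be {h, m}.  If m is high with a free
-- F-partner y, the path l – h – m – y is augmenting, and it is charged to the smaller of h and m only;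
-- in all other cases the frequent path is charged, except that for V_SH a path v₁ – m – h – v₄ of type
-- 3 or 4 is replaced by the augmenting path v₁ – m – h – l, which uses the kernel edge v₁ – m.
-- Distinct edges receive distinct bad nodes, distinct frequent paths and vertex-disjoint augmenting
-- paths, so |F| ≤ A(F) + b + (number of frequent paths of the admissible types).

module Submission where

open import Defs
open import Data.Bool as Bool using (Bool; true; false; _∧_; _∨_; not; if_then_else_)
open import Data.Bool.Properties using (∨-zeroʳ; T-≡)
open import Data.Empty using (⊥-elim)
open import Data.Fin using (Fin; toℕ) renaming (zero to fzero; suc to fsuc)
open import Data.Fin.Properties using (any?; toℕ-injective)
import Data.Fin as Fin
open import Data.List using (List; []; _∷_; _++_; length; filter; mapMaybe; tabulate; allFin)
open import Data.List.Properties using (filter-notAll; length-++)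
open import Data.List.Membership.Propositional using (_∈_)
open import Data.List.Membership.Propositional.Properties using (∈-filter⁺; ∈-++⁺ˡ; ∈-++⁺ʳ)
open import Data.List.Relation.Unary.All as All using (All; []; _∷_)
open import Data.List.Relation.Unary.All.Properties using (all-filter)
open import Data.List.Relation.Unary.AllPairs using (AllPairs; []; _∷_)
open import Data.List.Relation.Unary.Any as Any using (here; there)
open import Data.List.Relation.Unary.Unique.Propositional using (Unique)
import Data.List.Relation.Unary.Unique.Propositional.Properties as Unique
open import Data.List.Relation.Binary.Pointwise using (Pointwise; []; _∷_)
open import Data.List.Relation.Binary.Pointwise.Properties using (Pointwise-length)
open import Data.Maybe using (Maybe; just; nothing)
open import Data.Nat using (ℕ; zero; suc; z≤n; s≤s; _≤_; _<_; _+_; _<ᵇ_)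
import Data.Nat.Properties as ℕ
open import Data.Product using (∃; ∃₂; _×_; _,_; proj₁; proj₂)
open import Data.Product.Properties using (≡-dec)
open import Data.Rational using (_*_; _-_) renaming (_≤_ to _≤ℚ_)
open import Data.Sum using (_⊎_; inj₁; inj₂; [_,_]′; swap)
import Data.Sum as Sum
open import Function using (_∘_)
open import Function.Bundles using (Equivalence)
open import Relation.Binary.Definitions using (DecidableEquality; Tri; tri<; tri≈; tri>)
open import Relation.Binary.PropositionalEquality
open import Relation.Nullary using (¬_; ¬?; Dec; yes; no; does; ¬¬-excluded-middle)
open import Relation.Nullary.Decidable using (decidable-stable; dec-true; _×-dec_)
open import Relation.Nullary.Negation using (¬¬-map)
open import Relation.Unary using (Decidable)

∧-true : ∀ {a b} → (a ∧ b) ≡ true → a ≡ true × b ≡ true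
∧-true {true} b = refl , b

∨-true : ∀ {a b} → (a ∨ b) ≡ true → a ≡ true ⊎ b ≡ true
∨-true {true}  _ = inj₁ refl
∨-true {false} b = inj₂ b

sumFin-mono : ∀ {n} {f g : Fin n → ℕ} → (∀ k → f k ≤ g k) → sumFin f ≤ sumFin g
sumFin-mono {zero}  f≤g = z≤n
sumFin-mono {suc n} f≤g = ℕ.+-mono-≤ (f≤g fzero) (sumFin-mono (f≤g ∘ fsuc))

numTrue-mono : ∀ {n} {p q : Fin n → Bool} → (∀ k → p k ≡ true → q k ≡ true) → numTrue p ≤ numTrue q
numTrue-mono p⇒q = sumFin-mono (λ k → indicator-mono (p⇒q k))
  where
  indicator-mono : ∀ {b c : Bool} → (b ≡ true → c ≡ true) → (if b then 1 else 0) ≤ (if c then 1 else 0)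
  indicator-mono {false} _   = z≤n
  indicator-mono {true}  b⇒c rewrite b⇒c refl = ℕ.≤-refl

numTrue-pos : ∀ {n} (p : Fin n → Bool) {a} → p a ≡ true → 1 ≤ numTrue p
numTrue-pos p {fzero}  pa rewrite pa = s≤s z≤n
numTrue-pos p {fsuc a} pa = ℕ.≤-trans (numTrue-pos (p ∘ fsuc) pa) (ℕ.m≤n+m _ _)

numTrue-witness : ∀ {n} (p : Fin n → Bool) → 1 ≤ numTrue p → ∃ λ k → p k ≡ true
numTrue-witness {zero}  p ()
numTrue-witness {suc n} p pos with p fzero in p0
... | true  = fzero , p0
... | false = let k , pk = numTrue-witness (p ∘ fsuc) pos in fsuc k , pk

numTrue≤1-unique : ∀ {n} (p : Fin n → Bool) {a b} → numTrue p ≤ 1 → p a ≡ true → p b ≡ true → a ≡ b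
numTrue≤1-unique p {fzero}  {fzero}  _  _  _  = refl
numTrue≤1-unique p {fzero}  {fsuc b} ≤1 pa pb rewrite pa =
  ⊥-elim (ℕ.<-irrefl refl (ℕ.≤-trans (s≤s (numTrue-pos (p ∘ fsuc) pb)) ≤1))
numTrue≤1-unique p {fsuc a} {fzero}  ≤1 pa pb rewrite pb =
  ⊥-elim (ℕ.<-irrefl refl (ℕ.≤-trans (s≤s (numTrue-pos (p ∘ fsuc) pa)) ≤1))
numTrue≤1-unique p {fsuc a} {fsuc b} ≤1 pa pb =
  cong fsuc (numTrue≤1-unique (p ∘ fsuc) (ℕ.≤-trans (ℕ.m≤n+m _ _) ≤1) pa pb)

sumFin≤length-filter : ∀ {n} {A : Set} {P : A → Set} (P? : Decidable P) (f : Fin n → ℕ) (g : Fin n → A) →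
  (∀ k → f k ≤ 1) → (∀ k → 1 ≤ f k → P (g k)) → sumFin f ≤ length (filter P? (tabulate g))
sumFin≤length-filter {zero}  P? f g f≤1 f⇒P = z≤n
sumFin≤length-filter {suc n} P? f g f≤1 f⇒P
  with rest ← sumFin≤length-filter P? (f ∘ fsuc) (g ∘ fsuc) (f≤1 ∘ fsuc) (f⇒P ∘ fsuc) | P? (g fzero)
... | yes _  = ℕ.+-mono-≤ (f≤1 fzero) rest
... | no ¬P = ℕ.+-mono-≤ (ℕ.≤-pred (ℕ.≰⇒> (¬P ∘ f⇒P fzero))) rest

module _ {A : Set} (_≟_ : DecidableEquality A) where

  unique-⊆⇒length≤ : ∀ {xs ys : List A} → Unique xs → (∀ {x} → x ∈ xs → x ∈ ys) → length xs ≤ length ys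
  unique-⊆⇒length≤ {[]}     _              _    = z≤n
  unique-⊆⇒length≤ {x ∷ xs} {ys} (x∉xs ∷ uniq) xs⊆ys = ℕ.≤-trans
    (s≤s (unique-⊆⇒length≤ uniq λ y∈xs →
      ∈-filter⁺ (λ y → ¬? (x ≟ y)) (xs⊆ys (there y∈xs)) (All.lookup x∉xs y∈xs)))
    (filter-notAll (λ y → ¬? (x ≟ y)) ys (Any.map (λ x≡y x≢y → x≢y x≡y) (xs⊆ys (here refl))))

Covered : {A : Set} → (A → Set) → ℕ → Set
Covered {A} P k = ∃ λ (ys : List A) → length ys ≡ k × (∀ {x} → P x → x ∈ ys)

card⇒covered : ∀ {A : Set} {P : A → Set} {k} → Card P k → Covered P k
card⇒covered (ys , _ , ∈⇔P , len) = ys , len , λ {x} → Equivalence.from (∈⇔P x)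

covered-⊎ : ∀ {A : Set} {P Q : A → Set} {k l} → Covered P k → Covered Q l → Covered (λ x → P x ⊎ Q x) (k + l)
covered-⊎ (ys , refl , P⊆ys) (zs , refl , Q⊆zs) =
  ys ++ zs , length-++ ys , λ { (inj₁ p) → ∈-++⁺ˡ (P⊆ys p) ; (inj₂ q) → ∈-++⁺ʳ ys (Q⊆zs q) }

covered-bound : ∀ {A : Set} {P : A → Set} {k} → DecidableEquality A → Covered P k →
  ∀ {xs} → Unique xs → All P xs → length xs ≤ k
covered-bound _≟_ (ys , refl , P⊆ys) uniq all = unique-⊆⇒length≤ _≟_ uniq (P⊆ys ∘ All.lookup all)

module _ {A B : Set} (f : A → Maybe B) where

  All-mapMaybe⁺ : ∀ {P : A → Set} {Q : B → Set} {xs} → (∀ {x y} → f x ≡ just y → P x → Q y) →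
    All P xs → All Q (mapMaybe f xs)
  All-mapMaybe⁺ P⇒Q [] = []
  All-mapMaybe⁺ {xs = x ∷ _} P⇒Q (px ∷ pxs) with f x in fx
  ... | just y  = P⇒Q fx px ∷ All-mapMaybe⁺ P⇒Q pxs
  ... | nothing = All-mapMaybe⁺ P⇒Q pxs

  AllPairs-mapMaybe⁺ : ∀ {R : A → A → Set} {S : B → B → Set} {xs} →
    (∀ {x x' y y'} → f x ≡ just y → f x' ≡ just y' → R x x' → S y y') →
    AllPairs R xs → AllPairs S (mapMaybe f xs)
  AllPairs-mapMaybe⁺ R⇒S [] = []
  AllPairs-mapMaybe⁺ {xs = x ∷ _} R⇒S (rs ∷ rss) with f x in fx
  ... | just y  = All-mapMaybe⁺ (λ fx' → R⇒S fx fx') rs ∷ AllPairs-mapMaybe⁺ R⇒S rss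
  ... | nothing = AllPairs-mapMaybe⁺ R⇒S rss

module _ {A B : Set} {R : A → B → Set} where

  All-pointwise : ∀ {P : A → Set} {Q : B → Set} {xs ys} → (∀ {x y} → R x y → P x → Q y) →
    Pointwise R xs ys → All P xs → All Q ys
  All-pointwise R⇒ []         []         = []
  All-pointwise R⇒ (r ∷ rs)   (px ∷ pxs) = R⇒ r px ∷ All-pointwise R⇒ rs pxs

  AllPairs-pointwise : ∀ {S : A → A → Set} {T : B → B → Set} {xs ys} →
    (∀ {x x' y y'} → R x y → R x' y' → S x x' → T y y') →
    Pointwise R xs ys → AllPairs S xs → AllPairs T ys
  AllPairs-pointwise R⇒ []       []         = []
  AllPairs-pointwise R⇒ (r ∷ rs) (ss ∷ sss) = All-pointwise (R⇒ r) rs ss ∷ AllPairs-pointwise R⇒ rs sss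

  ¬¬-pointwise : ∀ {xs} → All (λ x → ¬ ¬ ∃ (R x)) xs → ¬ ¬ ∃ (Pointwise R xs)
  ¬¬-pointwise []           k = k ([] , [])
  ¬¬-pointwise (¬¬r ∷ ¬¬rs) k = ¬¬r λ (y , r) → ¬¬-pointwise ¬¬rs λ (ys , rs) → k (y ∷ ys , r ∷ rs)

module _ {n : ℕ} {H M : Graph n} (isMatching : IsMatching H M) where

  matching-sym : ∀ {u v} → Adj M u v → Adj M v u
  matching-sym {u} {v} a = trans (proj₁ (proj₁ isMatching) v u) a

  matching-irrefl : ∀ {u v} → Adj M u v → u ≢ v
  matching-irrefl {u} a refl with () ← trans (sym a) (proj₂ (proj₁ isMatching) u)

  matching-unique : ∀ {u v w} → Adj M u v → Adj M u w → v ≡ w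
  matching-unique {u} = numTrue≤1-unique (M u) (proj₂ (proj₂ isMatching) u)

  matching-uniqueˡ : ∀ {u v w} → Adj M v u → Adj M w u → v ≡ w
  matching-uniqueˡ a b = matching-unique (matching-sym a) (matching-sym b)

  matching-subgraph : ∀ {u v} → Adj M u v → Adj H u v
  matching-subgraph = proj₁ (proj₂ isMatching) _ _

∪ₑ-introˡ : ∀ {n} {H H' : Graph n} {u v} → Adj H u v → Adj (H ∪ₑ H') u v
∪ₑ-introˡ {H' = H'} {u} {v} a = cong (_∨ H' u v) a

∪ₑ-introʳ : ∀ {n} {H H' : Graph n} {u v} → Adj H' u v → Adj (H ∪ₑ H') u v
∪ₑ-introʳ {H = H} {u = u} {v} a = trans (cong (H u v ∨_) a) (∨-zeroʳ (H u v))

module _ {n : ℕ} {H M : Graph n} (isGraph : IsGraph M) where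

  private
    M-sym : ∀ {u v} → Adj M u v → Adj M v u
    M-sym {u} {v} a = trans (proj₁ isGraph v u) a

    free≢ : ∀ {u v w} → Unmatched M u → Adj M v w → u ≢ v
    free≢ u-free Mvw refl = u-free (_ , Mvw)

  augmentingPath₁ : ∀ {a b} → Adj H a b → Unmatched M a → Unmatched M b → a ≢ b →
    AugPath H M (a ∷ b ∷ [])
  augmentingPath₁ ab a-free b-free a≢b = record
    { alternating = one ab (λ Mab → a-free (_ , Mab))
    ; simple      = (a≢b ∷ []) ∷ [] ∷ []
    ; startFree   = λ { _ refl → a-free }
    ; endFree     = λ { _ refl → b-free } }

  augmentingPath₃ : ∀ {a b c d} → Adj H a b → Adj H b c → Adj M b c → Adj H c d →
    Unmatched M a → Unmatched M d → a ≢ d → AugPath H M (a ∷ b ∷ c ∷ d ∷ [])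
  augmentingPath₃ ab bc Mbc cd a-free d-free a≢d = record
    { alternating = more ab (λ Mab → a-free (_ , Mab))
                      (step bc Mbc (one cd (λ Mcd → d-free (_ , M-sym Mcd))))
    ; simple      = (free≢ a-free Mbc ∷ free≢ a-free (M-sym Mbc) ∷ a≢d ∷ [])
                  ∷ (b≢c ∷ (free≢ d-free Mbc ∘ sym) ∷ [])
                  ∷ ((free≢ d-free (M-sym Mbc) ∘ sym) ∷ [])
                  ∷ [] ∷ []
    ; startFree   = λ { _ refl → a-free }
    ; endFree     = λ { _ refl → d-free } }
    where
    b≢c : _ ≢ _
    b≢c refl with () ← trans (sym Mbc) (proj₂ isGraph _)

-- Degree classes

module ClassFacts {n : ℕ} (d i : ℕ) (K : Graph n) (d≥1 : 1 ≤ d) (i≤ : i ≤ 50000000) where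

  open Classes d i K
  open import Data.Integer as ℤ using ()
  import Data.Integer.Properties as ℤ
  import Data.Nat.Coprimality as Coprime
  open import Data.Rational using (ℚ; -_; *≤*; NonNegative; Positive; nonNegative) renaming (_+_ to _+ℚ_; _<_ to _<ℚ_)
  open import Data.Rational.Properties
  open import Relation.Nullary.Decidable using (toWitness)

  private
    sound : ∀ {A : Set} (a? : Dec A) → does a? ≡ true → A
    sound (yes a) _ = a

    ⟦⟧-mono : ∀ {m k} → m ≤ k → ⟦ m ⟧ ≤ℚ ⟦ k ⟧
    ⟦⟧-mono {m} {k} m≤k
      rewrite normalize-coprime (Coprime.sym (Coprime.1-coprimeTo m))
            | normalize-coprime (Coprime.sym (Coprime.1-coprimeTo k)) =
      *≤* (subst₂ ℤ._≤_ (sym (ℤ.*-identityʳ _)) (sym (ℤ.*-identityʳ _)) (ℤ.+≤+ m≤k))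

    instance
      d-nonNeg : NonNegative ⟦ d ⟧
      d-nonNeg = nonNegative (⟦⟧-mono {0} {d} z≤n)

    cancel-pos : ∀ k {p q} → 1 ≤ k → ⟦ k ⟧ * p ≤ℚ ⟦ k ⟧ * q → p ≤ℚ q
    cancel-pos (suc k) _ = *-cancelˡ-≤-pos ⟦ suc k ⟧ {{pos}}
      where
      pos : Positive ⟦ suc k ⟧
      pos rewrite normalize-coprime (Coprime.sym (Coprime.1-coprimeTo (suc k))) = _

    -- ⟦ 50000000 ⟧ * (ε * ε) reduces to ε
    iε²≤ε : iε² ≤ℚ ε
    iε²≤ε = *-monoʳ-≤-nonNeg (ε * ε) {{nonNeg*nonNeg⇒nonNeg ε ε}} (⟦⟧-mono i≤)

    2s≥ε : ⟦ 1 ⟧ - ⟦ 2 ⟧ * s ≤ℚ ⟦ 1 ⟧ - ε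
    2s≥ε = toWitness {a? = (⟦ 1 ⟧ - ⟦ 2 ⟧ * s) ≤? (⟦ 1 ⟧ - ε)} _

    high low : ℚ
    high = ⟦ d ⟧ * (⟦ 1 ⟧ - ⟦ 2 ⟧ * s - iε²)
    low  = ⟦ d ⟧ * (s +ℚ iε²)

    <⇒≱ : ∀ {p q} → p <ℚ q → ¬ q ≤ℚ p
    <⇒≱ p<q q≤p = <-irrefl refl (<-≤-trans p<q q≤p)

    gap : s +ℚ ε <ℚ (⟦ 1 ⟧ - ⟦ 2 ⟧ * s) - ε
    gap = toWitness {a? = (s +ℚ ε) <? ((⟦ 1 ⟧ - ⟦ 2 ⟧ * s) - ε)} _

  SH⇒H : ∀ {v} → SH v → H v
  SH⇒H {v} sh = dec-true (high ≤? dk v)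
    (≤-trans (*-monoˡ-≤-nonNeg ⟦ d ⟧ (+-monoˡ-≤ (- iε²) 2s≥ε)) (sound (_ ≤? dk v) sh))

  H⇒¬L : ∀ {v} → H v → ¬ L v
  H⇒¬L {v} h l = <⇒≱ gap (cancel-pos d d≥1 (begin
    ⟦ d ⟧ * ((⟦ 1 ⟧ - ⟦ 2 ⟧ * s) - ε)    ≤⟨ *-monoˡ-≤-nonNeg ⟦ d ⟧ (+-monoʳ-≤ _ (neg-antimono-≤ iε²≤ε)) ⟩
    high                                ≤⟨ sound (high ≤? dk v) h ⟩
    dk v                                ≤⟨ sound (dk v ≤? low) l ⟩
    low                                 ≤⟨ *-monoˡ-≤-nonNeg ⟦ d ⟧ (+-monoʳ-≤ s iε²≤ε) ⟩
    ⟦ d ⟧ * (s +ℚ ε)                    ∎))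
    where open ≤-Reasoning

  H⇒¬Mid : ∀ {v} → H v → ¬ M' v
  H⇒¬Mid {v} h mid = <⇒≱ (sound (dk v <? high) (proj₂ (∧-true mid))) (sound (high ≤? dk v) h)

  L⇒¬Mid : ∀ {v} → L v → ¬ M' v
  L⇒¬Mid {v} l mid = <⇒≱ (sound (low <? dk v) (proj₁ (∧-true mid))) (sound (dk v ≤? low) l)

-- Frequent length-three augmenting paths

PairOf : ∀ {n} → Fin n × Fin n → Fin n → Fin n → Set
PairOf x a b = x ≡ (a , b) ⊎ x ≡ (b , a)

pairOf-cases : ∀ {n} {x : Fin n × Fin n} {a b a' b'} → PairOf x a b → PairOf x a' b' →
  a ≡ a' ⊎ (a ≡ b' × b ≡ a')
pairOf-cases (inj₁ refl) (inj₁ refl) = inj₁ refl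
pairOf-cases (inj₁ refl) (inj₂ refl) = inj₂ (refl , refl)
pairOf-cases (inj₂ refl) (inj₁ refl) = inj₂ (refl , refl)
pairOf-cases (inj₂ refl) (inj₂ refl) = inj₁ refl

-- The start v₁ of a frequent path of type 3 or 4 whose second vertex is v₂.
record Detour {n} (K M M* : Graph n) (mid : Fin n → Bool) (v₂ : Fin n) : Set where
  constructor detour
  field
    start     : Fin n
    kernel    : Adj K start v₂
    optimal   : Adj M* start v₂
    startFree : Unmatched M start
    startMid  : mid start ≡ true

module FrequentFacts {n : ℕ} (d i : ℕ) (K M M* : Graph n) (isM : IsMatching K M)
  (d≥1 : 1 ≤ d) (i≤ : i ≤ 50000000) where

  open Classes d i K
  open Frequent d i K M M*
  open ClassFacts d i K d≥1 i≤

  FreqMiddle : ℕ → Fin n → Fin n → Set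
  FreqMiddle j a b = ∃₂ λ v₁ v₄ → FreqLabeled j v₁ a b v₄ ⊎ FreqLabeled j v₁ b a v₄

  typeCond-range : ∀ j {v₁ v₂ v₃ v₄} → TypeCond j v₁ v₂ v₃ v₄ → (j ≡ 1 ⊎ j ≡ 2) ⊎ (j ≡ 3 ⊎ j ≡ 4)
  typeCond-range 1 _ = inj₁ (inj₁ refl)
  typeCond-range 2 _ = inj₁ (inj₂ refl)
  typeCond-range 3 _ = inj₂ (inj₁ refl)
  typeCond-range 4 _ = inj₂ (inj₂ refl)
  typeCond-range 0 ()
  typeCond-range (suc (suc (suc (suc (suc _))))) ()

  freqMiddle-range : ∀ {j a b} → FreqMiddle j a b → (j ≡ 1 ⊎ j ≡ 2) ⊎ (j ≡ 3 ⊎ j ≡ 4)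
  freqMiddle-range {j} (_ , _ , inj₁ (_ , _ , tc)) = typeCond-range j tc
  freqMiddle-range {j} (_ , _ , inj₂ (_ , _ , tc)) = typeCond-range j tc

  middleClasses : ∀ j {v₁ v₂ v₃ v₄} → TypeCond j v₁ v₂ v₃ v₄ → (H v₂ ⊎ M' v₂) × SH v₃
  middleClasses 1 (_ , sh₂ , sh₃ , _)     = inj₁ (SH⇒H sh₂) , sh₃
  middleClasses 2 (_ , h¬sh₂ , sh₃ , _)   = inj₁ (proj₁ (∧-true h¬sh₂)) , sh₃
  middleClasses 3 (_ , h¬sh₂ , sh₃ , _)   = inj₁ (proj₁ (∧-true h¬sh₂)) , sh₃
  middleClasses 4 (_ , mid₂ , sh₃ , _)    = inj₂ mid₂ , sh₃
  middleClasses 0 ()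
  middleClasses (suc (suc (suc (suc (suc _))))) ()

  low-notOnFrequent : ∀ {v} → L v → Matched M v → ¬ OnFrequent v
  low-notOnFrequent l mv (_ , _ , _ , _ , _ , ((_ , _ , _ , v₁-free , _) , _ , _) , inj₁ refl) = v₁-free mv
  low-notOnFrequent l mv (j , _ , _ , _ , _ , (_ , _ , tc) , inj₂ (inj₁ refl)) =
    [ (λ h → H⇒¬L h l) , L⇒¬Mid l ]′ (proj₁ (middleClasses j tc))
  low-notOnFrequent l mv (j , _ , _ , _ , _ , (_ , _ , tc) , inj₂ (inj₂ (inj₁ refl))) =
    H⇒¬L (SH⇒H (proj₂ (middleClasses j tc))) l
  low-notOnFrequent l mv (_ , _ , _ , _ , _ , ((_ , _ , _ , _ , v₄-free) , _ , _) , inj₂ (inj₂ (inj₂ refl))) =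
    v₄-free mv

  onFrequent⇒freqMiddle : ∀ {h m} → Adj M h m → OnFrequent h → ∃ λ j → FreqMiddle j h m
  onFrequent⇒freqMiddle Mhm (_ , _ , _ , _ , _ , ((_ , _ , _ , v₁-free , _) , _) , inj₁ refl) =
    ⊥-elim (v₁-free (_ , Mhm))
  onFrequent⇒freqMiddle Mhm (j , v₁ , _ , _ , v₄ , lab@((_ , M₂₃ , _) , _) , inj₂ (inj₁ refl)) =
    j , v₁ , v₄ , inj₁ (subst (λ v₃ → FreqLabeled j v₁ _ v₃ v₄) (matching-unique isM M₂₃ Mhm) lab)
  onFrequent⇒freqMiddle Mhm (j , v₁ , _ , _ , v₄ , lab@((_ , M₂₃ , _) , _) , inj₂ (inj₂ (inj₁ refl))) =
    j , v₁ , v₄ , inj₂ (subst (λ v₂ → FreqLabeled j v₁ v₂ _ v₄) (matching-uniqueˡ isM M₂₃ (matching-sym isM Mhm)) lab)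
  onFrequent⇒freqMiddle Mhm (_ , _ , _ , _ , _ , ((_ , _ , _ , _ , v₄-free) , _) , inj₂ (inj₂ (inj₂ refl))) =
    ⊥-elim (v₄-free (_ , Mhm))

  freqMiddle⇒freqPath : ∀ {j a b} → Adj M a b → FreqMiddle j a b → ∃ λ x → PairOf x a b × FreqPath j x
  freqMiddle⇒freqPath {j} {a} {b} Mab (v₁ , v₄ , lab) with ℕ.<-cmp (toℕ a) (toℕ b)
  ... | tri< a<b _ _ = (a , b) , inj₁ refl , a<b , v₁ , v₄ , lab
  ... | tri≈ _ a≡b _ = ⊥-elim (matching-irrefl isM Mab (toℕ-injective a≡b))
  ... | tri> _ _ b<a = (b , a) , inj₂ refl , b<a , v₁ , v₄ , swap lab

  AnyType : Fin n × Fin n → Set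
  AnyType x = ((FreqPath 1 x ⊎ FreqPath 2 x) ⊎ FreqPath 3 x) ⊎ FreqPath 4 x

  freqPath-anyType : ∀ {j x} → FreqPath j x → AnyType x
  freqPath-anyType fp = byType (freqMiddle-range (proj₂ fp)) fp
    where
    byType : ∀ {j x} → (j ≡ 1 ⊎ j ≡ 2) ⊎ (j ≡ 3 ⊎ j ≡ 4) → FreqPath j x → AnyType x
    byType (inj₁ (inj₁ refl)) fp = inj₁ (inj₁ (inj₁ fp))
    byType (inj₁ (inj₂ refl)) fp = inj₁ (inj₁ (inj₂ fp))
    byType (inj₂ (inj₁ refl)) fp = inj₁ (inj₂ fp)
    byType (inj₂ (inj₂ refl)) fp = inj₂ fp

  resolve-H : ∀ {h m} → Adj M h m → OnFrequent h → ∃ λ x → PairOf x h m × AnyType x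
  resolve-H Mhm onFreq =
    let _ , middle    = onFrequent⇒freqMiddle Mhm onFreq
        x , pair , fp = freqMiddle⇒freqPath Mhm middle
    in  x , pair , freqPath-anyType fp

  typeThreeFour : ∀ {j v₁ v₂ v₃ v₄} → (j ≡ 3 ⊎ j ≡ 4) → TypeCond j v₁ v₂ v₃ v₄ →
    M' v₁ × ¬ SH v₂ × Adj K v₁ v₂
  typeThreeFour (inj₁ refl) (mid₁ , h¬sh₂ , _ , _ , k₁₂) = mid₁ , not-true⇒≢ (proj₂ (∧-true h¬sh₂)) , k₁₂
    where
    not-true⇒≢ : ∀ {b} → not b ≡ true → b ≢ true
    not-true⇒≢ {false} _ ()
  typeThreeFour (inj₂ refl) (mid₁ , mid₂ , _ , _ , k₁₂) = mid₁ , (λ sh₂ → H⇒¬Mid (SH⇒H sh₂) mid₂) , k₁₂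

  -- A superheavy vertex can only be v₃ on a path of type 3 or 4, so its mate is v₂.
  detourAt : ∀ {j h m} → (j ≡ 3 ⊎ j ≡ 4) → SH h → FreqMiddle j h m → Detour K M M* inM m × ¬ SH m
  detourAt j34 sh (_ , _ , inj₁ (_ , _ , tc)) = ⊥-elim (proj₁ (proj₂ (typeThreeFour j34 tc)) sh)
  detourAt j34 sh (v₁ , _ , inj₂ ((M*₁₂ , _ , _ , v₁-free , _) , _ , tc)) =
    let mid₁ , ¬sh₂ , k₁₂ = typeThreeFour j34 tc in detour v₁ k₁₂ M*₁₂ v₁-free mid₁ , ¬sh₂

  resolve-SH : ∀ {h m} → SH h → Adj M h m → OnFrequent h →
    (∃ λ x → PairOf x h m × (FreqPath 1 x ⊎ FreqPath 2 x)) ⊎ (Detour K M M* inM m × ¬ SH m)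
  resolve-SH sh Mhm onFreq = let _ , middle = onFrequent⇒freqMiddle Mhm onFreq in
    byType (freqMiddle-range middle) middle
    where
    byType : ∀ {j} → (j ≡ 1 ⊎ j ≡ 2) ⊎ (j ≡ 3 ⊎ j ≡ 4) → FreqMiddle j _ _ →
      (∃ λ x → PairOf x _ _ × (FreqPath 1 x ⊎ FreqPath 2 x)) ⊎ (Detour K M M* inM _ × ¬ SH _)
    byType (inj₁ (inj₁ refl)) middle = let x , pair , fp = freqMiddle⇒freqPath {j = 1} Mhm middle in inj₁ (x , pair , inj₁ fp)
    byType (inj₁ (inj₂ refl)) middle = let x , pair , fp = freqMiddle⇒freqPath {j = 2} Mhm middle in inj₁ (x , pair , inj₂ fp)
    byType (inj₂ j34)         middle = inj₂ (detourAt j34 sh middle)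

-- Charges

data Charge (n : ℕ) : Set where
  augmenting : List (Fin n) → Charge n
  bad        : Fin n → Charge n
  frequent   : Fin n × Fin n → Charge n

module _ {n : ℕ} where

  augmenting? : Charge n → Maybe (List (Fin n))
  augmenting? (augmenting p) = just p
  augmenting? _              = nothing

  bad? : Charge n → Maybe (Fin n)
  bad? (bad v) = just v
  bad? _       = nothing

  frequent? : Charge n → Maybe (Fin n × Fin n)
  frequent? (frequent x) = just x
  frequent? _            = nothing

  augmenting?-just : ∀ {c p} → augmenting? c ≡ just p → c ≡ augmenting p
  augmenting?-just {augmenting _} refl = refl

  bad?-just : ∀ {c v} → bad? c ≡ just v → c ≡ bad v
  bad?-just {bad _} refl = refl

  frequent?-just : ∀ {c x} → frequent? c ≡ just x → c ≡ frequent x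
  frequent?-just {frequent _} refl = refl

  length-charges : ∀ cs → length cs ≡
    length (mapMaybe augmenting? cs) + length (mapMaybe bad? cs) + length (mapMaybe frequent? cs)
  length-charges []                  = refl
  length-charges (augmenting _ ∷ cs) = cong suc (length-charges cs)
  length-charges (bad _ ∷ cs)        = trans (cong suc (length-charges cs))
    (cong (_+ length (mapMaybe frequent? cs)) (sym (ℕ.+-suc (length (mapMaybe augmenting? cs)) _)))
  length-charges (frequent _ ∷ cs)   = trans (cong suc (length-charges cs))
    (sym (ℕ.+-suc (length (mapMaybe augmenting? cs) + length (mapMaybe bad? cs)) _))

  Apart : Charge n → Charge n → Set
  Apart c c' = (∀ {p q} → c ≡ augmenting p → c' ≡ augmenting q → Disjoint p q)
             × (∀ {v w} → c ≡ bad v → c' ≡ bad w → v ≢ w)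
             × (∀ {x y} → c ≡ frequent x → c' ≡ frequent y → x ≢ y)

module ChargeCount {n : ℕ} (H M : Graph n) (BadOK : Fin n → Set) (FreqOK : Fin n × Fin n → Set) where

  Legit : Charge n → Set
  Legit (augmenting p) = AugPath H M p
  Legit (bad v)        = BadOK v
  Legit (frequent x)   = FreqOK x

  charges-bound : ∀ {cs a b N} → IsMaxNumDisjointAug H M a → Covered BadOK b → Covered FreqOK N →
    AllPairs Apart cs → All Legit cs → length cs ≤ a + b + N
  charges-bound {cs} {a} {b} {N} isMax badCover freqCover apart legit = begin
    length cs
      ≡⟨ length-charges cs ⟩
    length (mapMaybe augmenting? cs) + length (mapMaybe bad? cs) + length (mapMaybe frequent? cs)
      ≤⟨ ℕ.+-mono-≤ (ℕ.+-mono-≤ paths≤a bads≤b) frequents≤N ⟩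
    a + b + N ∎
    where
    open ℕ.≤-Reasoning
    paths≤a = proj₂ isMax _
      ( All-mapMaybe⁺ augmenting? (λ eq → subst Legit (augmenting?-just eq)) legit
      , AllPairs-mapMaybe⁺ augmenting? (λ eq eq' apart → proj₁ apart (augmenting?-just eq) (augmenting?-just eq')) apart )
    bads≤b = covered-bound Fin._≟_ badCover
      (AllPairs-mapMaybe⁺ bad? (λ eq eq' apart → proj₁ (proj₂ apart) (bad?-just eq) (bad?-just eq')) apart)
      (All-mapMaybe⁺ bad? (λ eq → subst Legit (bad?-just eq)) legit)
    frequents≤N = covered-bound (≡-dec Fin._≟_ Fin._≟_) freqCover
      (AllPairs-mapMaybe⁺ frequent? (λ eq eq' apart → proj₂ (proj₂ apart) (frequent?-just eq) (frequent?-just eq')) apart)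
      (All-mapMaybe⁺ frequent? (λ eq → subst Legit (frequent?-just eq)) legit)

-- Charging the edges of a matching in G[hi, lo]

module Charging {n : ℕ} (G K M M* F : Graph n) (hi lo mid : Fin n → Bool)
  (isM : IsMatching K M) (isM* : IsMatching G M*) (isF : IsMatching (bip G hi lo) F)
  (high⇒¬low : ∀ {v} → hi v ≡ true → lo v ≢ true)
  (high⇒¬mid : ∀ {v} → hi v ≡ true → mid v ≢ true)
  (low⇒¬mid  : ∀ {v} → lo v ≡ true → mid v ≢ true)
  (OnFrequent : Fin n → Set)
  (low-notOnFrequent : ∀ {v} → lo v ≡ true → Matched M v → ¬ OnFrequent v)
  (Allowed : Fin n × Fin n → Set)
  (resolve : ∀ {h m} → hi h ≡ true → Adj M h m → OnFrequent h →
     (∃ λ x → PairOf x h m × Allowed x) ⊎ (Detour K M M* mid m × hi m ≢ true))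
  where

  High Low Mid Bad : Fin n → Set
  High v = hi v ≡ true
  Low  v = lo v ≡ true
  Mid  v = mid v ≡ true
  Bad  v = Matched M v × ¬ OnFrequent v

  open ChargeCount (K ∪ₑ F) M Bad Allowed

  F-orient : ∀ {u w} → Adj F u w → (High u × Low w) ⊎ (Low u × High w)
  F-orient Fuw = Sum.map ∧-true ∧-true (∨-true (proj₂ (∧-true (matching-subgraph isF Fuw))))

  K-edge : ∀ {u v} → Adj K u v → Adj (K ∪ₑ F) u v
  K-edge = ∪ₑ-introˡ {H = K} {H' = F}

  F-edge : ∀ {u v} → Adj F u v → Adj (K ∪ₑ F) u v
  F-edge = ∪ₑ-introʳ {H = K} {H' = F}

  F-partner-low : ∀ {h l} → High h → Adj F h l → Low l
  F-partner-low hh Fhl = [ proj₂ , (λ (lh , _) → ⊥-elim (high⇒¬low hh lh)) ]′ (F-orient Fhl)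

  Extendable : Fin n → Set
  Extendable v = High v × ∃ λ y → Adj F v y × Unmatched M y

  -- A path through an M-edge with two high ends is charged to the smaller end only.
  BeforeHighMate : Fin n → Set
  BeforeHighMate h = ∀ {m} → Adj M h m → High m → toℕ h < toℕ m

  SameMEdge : Fin n → Fin n → Set
  SameMEdge h a = h ≡ a ⊎ Adj M h a

  -- The vertices of a path charged to h are h, its M-mate, and free vertices one F- or M*-edge away
  -- from these; this is what makes paths charged to different edges vertex-disjoint.
  data Role (h : Fin n) : Fin n → Set where
    onMEdge : ∀ {z}   → SameMEdge h z → Role h z
    viaF    : ∀ {a z} → Adj F a z → Low z → Unmatched M z → SameMEdge h a → Role h z
    viaM*   : ∀ {a z} → Adj M* z a → Mid z → Unmatched M z → SameMEdge h a → Role h z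

  data ChargeOf (h : Fin n) : Charge n → Set where
    lowBad     : ∀ {l} → Adj F h l → Matched M l → ChargeOf h (bad l)
    highBad    : Bad h → ChargeOf h (bad h)
    augmenting : ∀ {p} → AugPath (K ∪ₑ F) M p → BeforeHighMate h → All (Role h) p →
                 ChargeOf h (augmenting p)
    frequent   : ∀ {m x} → PairOf x h m → Allowed x → Extendable h → (Extendable m → toℕ m < toℕ h) →
                 ChargeOf h (frequent x)

  singleEdge : ∀ {h l} → High h → Adj F h l → Unmatched M h → Unmatched M l →
    ChargeOf h (augmenting (h ∷ l ∷ []))
  singleEdge hh Fhl h-free l-free = augmenting
    (augmentingPath₁ (proj₁ isM) (F-edge Fhl) h-free l-free λ { refl → high⇒¬low hh (F-partner-low hh Fhl) })
    (λ Mhm _ → ⊥-elim (h-free (_ , Mhm)))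
    (onMEdge (inj₁ refl) ∷ viaF Fhl (F-partner-low hh Fhl) l-free (inj₁ refl) ∷ [])

  throughMate : ∀ {h l m y} → High h → Adj F h l → Unmatched M l → Adj M h m →
    High m → Adj F m y → Unmatched M y → toℕ h < toℕ m → ChargeOf h (augmenting (l ∷ h ∷ m ∷ y ∷ []))
  throughMate {h} hh Fhl l-free Mhm hm Fmy y-free h<m = augmenting
    (augmentingPath₃ (proj₁ isM) (F-edge (matching-sym isF Fhl)) (K-edge (matching-subgraph isM Mhm)) Mhm
      (F-edge Fmy) l-free y-free λ { refl → matching-irrefl isM Mhm (matching-uniqueˡ isF Fhl Fmy) })
    (λ Mhm' _ → subst (λ m' → toℕ h < toℕ m') (matching-unique isM Mhm Mhm') h<m)
    ( viaF Fhl (F-partner-low hh Fhl) l-free (inj₁ refl) ∷ onMEdge (inj₁ refl) ∷ onMEdge (inj₂ Mhm)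
    ∷ viaF Fmy (F-partner-low hm Fmy) y-free (inj₂ Mhm) ∷ [])

  throughDetour : ∀ {h l m} → High h → Adj F h l → Unmatched M l → Adj M h m →
    (t : Detour K M M* mid m) → ¬ High m → ChargeOf h (augmenting (Detour.start t ∷ m ∷ h ∷ l ∷ []))
  throughDetour hh Fhl l-free Mhm (detour v₁ Kv₁m M*v₁m v₁-free mid₁) m-low = augmenting
    (augmentingPath₃ (proj₁ isM) (K-edge Kv₁m) (K-edge (matching-subgraph isM Mmh)) Mmh (F-edge Fhl)
      v₁-free l-free λ { refl → low⇒¬mid (F-partner-low hh Fhl) mid₁ })
    (λ Mhm' hm' → ⊥-elim (m-low (subst High (sym (matching-unique isM Mhm Mhm')) hm')))
    ( viaM* M*v₁m mid₁ v₁-free (inj₂ Mhm) ∷ onMEdge (inj₂ Mhm) ∷ onMEdge (inj₁ refl)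
    ∷ viaF Fhl (F-partner-low hh Fhl) l-free (inj₁ refl) ∷ [])
    where Mmh = matching-sym isM Mhm

  chargeOnFrequent : ∀ {h l m} → High h → Adj F h l → Unmatched M l → Adj M h m → OnFrequent h →
    ¬ ¬ ∃ (ChargeOf h)
  chargeOnFrequent {h} {l} {m} hh Fhl l-free Mhm onFreq none =
    ¬¬-excluded-middle (none ∘ byMate (ℕ.<-cmp (toℕ h) (toℕ m)))
    where
    resolved : (Extendable m → toℕ m < toℕ h) → ∃ (ChargeOf h)
    resolved yields =
      [ (λ (_ , pair , allowed) → _ , frequent pair allowed (hh , l , Fhl , l-free) yields)
      , (λ (t , m-low) → _ , throughDetour hh Fhl l-free Mhm t m-low)
      ]′ (resolve hh Mhm onFreq)

    byMate : Tri (toℕ h < toℕ m) (toℕ h ≡ toℕ m) (toℕ m < toℕ h) → Dec (Extendable m) → ∃ (ChargeOf h)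
    byMate _              (no ¬extendable)              = resolved (⊥-elim ∘ ¬extendable)
    byMate (tri< h<m _ _) (yes (hm , _ , Fmy , y-free)) = _ , throughMate hh Fhl l-free Mhm hm Fmy y-free h<m
    byMate (tri≈ _ h≡m _) (yes _)                       = ⊥-elim (matching-irrefl isM Mhm (toℕ-injective h≡m))
    byMate (tri> _ _ m<h) (yes _)                       = resolved (λ _ → m<h)

  chargeable : ∀ {h l} → High h → Adj F h l → ¬ ¬ ∃ (ChargeOf h)
  chargeable hh Fhl none = ¬¬-excluded-middle λ where
    (yes l-matched) → none (_ , lowBad Fhl l-matched)
    (no l-free) → ¬¬-excluded-middle λ where
      (no h-free) → none (_ , singleEdge hh Fhl h-free l-free)
      (yes (m , Mhm)) → none (_ , highBad ((m , Mhm) , λ onFreq → chargeOnFrequent hh Fhl l-free Mhm onFreq none))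

  Owner : Fin n → Set
  Owner h = High h × BeforeHighMate h

  mates-not-owners : ∀ {h h'} → Owner h → Owner h' → ¬ Adj M h h'
  mates-not-owners (hh , before) (hh' , before') Mhh' =
    ℕ.<-asym (before Mhh' hh') (before' (matching-sym isM Mhh') hh)

  owners-agree : ∀ {h h' a} → Owner h → Owner h' → SameMEdge h a → SameMEdge h' a → h ≡ h'
  owners-agree _ _  (inj₁ refl) (inj₁ refl)  = refl
  owners-agree o o' (inj₁ refl) (inj₂ Mh'h)  = ⊥-elim (mates-not-owners o' o Mh'h)
  owners-agree o o' (inj₂ Mhh') (inj₁ refl)  = ⊥-elim (mates-not-owners o o' Mhh')
  owners-agree _ _  (inj₂ Mha)  (inj₂ Mh'a)  = matching-uniqueˡ isM Mha Mh'a

  free-on-MEdge : ∀ {h z} → High h → SameMEdge h z → Unmatched M z → High z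
  free-on-MEdge hh (inj₁ refl) _      = hh
  free-on-MEdge hh (inj₂ Mhz)  z-free = ⊥-elim (z-free (_ , matching-sym isM Mhz))

  roles-agree : ∀ {h h' z} → Owner h → Owner h' → Role h z → Role h' z → h ≡ h'
  roles-agree o o' (onMEdge s) (onMEdge s') = owners-agree o o' s s'
  roles-agree o o' (viaF Faz _ _ s) (viaF Fa'z _ _ s') =
    owners-agree o o' s (subst (SameMEdge _) (matching-uniqueˡ isF Fa'z Faz) s')
  roles-agree o o' (viaM* M*za _ _ s) (viaM* M*za' _ _ s') =
    owners-agree o o' s (subst (SameMEdge _) (matching-unique isM* M*za' M*za) s')
  roles-agree (hh , _) _ (onMEdge s) (viaF _ lz z-free _)  = ⊥-elim (high⇒¬low (free-on-MEdge hh s z-free) lz)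
  roles-agree (hh , _) _ (onMEdge s) (viaM* _ mz z-free _) = ⊥-elim (high⇒¬mid (free-on-MEdge hh s z-free) mz)
  roles-agree _ (hh' , _) (viaF _ lz z-free _) (onMEdge s')  = ⊥-elim (high⇒¬low (free-on-MEdge hh' s' z-free) lz)
  roles-agree _ (hh' , _) (viaM* _ mz z-free _) (onMEdge s') = ⊥-elim (high⇒¬mid (free-on-MEdge hh' s' z-free) mz)
  roles-agree _ _ (viaF _ lz _ _) (viaM* _ mz _ _) = ⊥-elim (low⇒¬mid lz mz)
  roles-agree _ _ (viaM* _ mz _ _) (viaF _ lz _ _) = ⊥-elim (low⇒¬mid lz mz)

  augmentingCharges-meet : ∀ {h h' p q z} → High h → High h' →
    ChargeOf h (augmenting p) → ChargeOf h' (augmenting q) → z ∈ p → z ∈ q → h ≡ h'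
  augmentingCharges-meet hh hh' (augmenting _ before roles) (augmenting _ before' roles') z∈p z∈q =
    roles-agree (hh , before) (hh' , before') (All.lookup roles z∈p) (All.lookup roles' z∈q)

  badCharges-injective : ∀ {h h' v w} → High h → High h' →
    ChargeOf h (bad v) → ChargeOf h' (bad w) → v ≡ w → h ≡ h'
  badCharges-injective _  _   (lowBad Fhl _) (lowBad Fh'l _) refl = matching-uniqueˡ isF Fhl Fh'l
  badCharges-injective hh hh' (lowBad Fhl _) (highBad _)     refl = ⊥-elim (high⇒¬low hh' (F-partner-low hh Fhl))
  badCharges-injective hh hh' (highBad _)    (lowBad Fh'l _) refl = ⊥-elim (high⇒¬low hh (F-partner-low hh' Fh'l))
  badCharges-injective _  _   (highBad _)    (highBad _)     refl = refl

  -- Two charged frequent paths sharing their middle edge {h, h'} would force both h < h' and h' < h.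
  frequentCharges-injective : ∀ {h h' x y} → ChargeOf h (frequent x) → ChargeOf h' (frequent y) → x ≡ y → h ≡ h'
  frequentCharges-injective (frequent pair _ ext yields) (frequent pair' _ ext' yields') refl
    with pairOf-cases pair pair'
  ... | inj₁ h≡h'          = h≡h'
  ... | inj₂ (refl , refl) = ⊥-elim (ℕ.<-asym (yields ext') (yields' ext))

  -- `size` counts every edge of F at its endpoint of smaller index.
  LowerEnd : Fin n → Set
  LowerEnd u = ∃ λ w → toℕ u < toℕ w × Adj F u w

  lowerEnd? : Decidable LowerEnd
  lowerEnd? u = any? λ w → (toℕ u ℕ.<? toℕ w) ×-dec (F u w Bool.≟ true)

  lowerEnds : List (Fin n)
  lowerEnds = filter lowerEnd? (allFin n)

  size≤length-lowerEnds : size F ≤ length lowerEnds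
  size≤length-lowerEnds = sumFin≤length-filter lowerEnd? _ (λ u → u) edgesAbove≤1 edgesAbove⇒lowerEnd
    where
    edgesAbove≤1 : ∀ u → numTrue (λ w → (toℕ u <ᵇ toℕ w) ∧ F u w) ≤ 1
    edgesAbove≤1 u = ℕ.≤-trans (numTrue-mono {q = F u} (λ _ → proj₂ ∘ ∧-true)) (proj₂ (proj₂ isF) u)

    edgesAbove⇒lowerEnd : ∀ u → 1 ≤ numTrue (λ w → (toℕ u <ᵇ toℕ w) ∧ F u w) → LowerEnd u
    edgesAbove⇒lowerEnd u pos =
      let w , above = numTrue-witness _ pos
          u<ᵇw , Fuw = ∧-true above
      in  w , ℕ.<ᵇ⇒< _ _ (Equivalence.from T-≡ u<ᵇw) , Fuw

  SmallerEnd : Fin n → Fin n → Set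
  SmallerEnd u h = ∃ λ w → toℕ u < toℕ w × Adj F u w × (h ≡ u ⊎ h ≡ w)

  smallerEnd-unique : ∀ {u u' h} → SmallerEnd u h → SmallerEnd u' h → u ≡ u'
  smallerEnd-unique (_ , _ , _ , inj₁ refl) (_ , _ , _ , inj₁ refl) = refl
  smallerEnd-unique (w , u<w , Fuw , inj₁ refl) (_ , u'<u , Fu'u , inj₂ refl) =
    ⊥-elim (ℕ.<-asym u<w (subst (λ v → toℕ v < toℕ _) (matching-unique isF (matching-sym isF Fu'u) Fuw) u'<u))
  smallerEnd-unique (_ , u<u' , Fuu' , inj₂ refl) (w' , u'<w' , Fu'w' , inj₁ refl) =
    ⊥-elim (ℕ.<-asym u'<w' (subst (λ v → toℕ v < toℕ _) (matching-unique isF (matching-sym isF Fuu') Fu'w') u<u'))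
  smallerEnd-unique (_ , _ , Fuh , inj₂ refl) (_ , _ , Fu'h , inj₂ refl) = matching-uniqueˡ isF Fuh Fu'h

  Charges : Fin n → Charge n → Set
  Charges u c = ∃ λ h → SmallerEnd u h × High h × ChargeOf h c

  lowerEnd-charges : ∀ {u} → LowerEnd u → ¬ ¬ ∃ (Charges u)
  lowerEnd-charges {u} (w , u<w , Fuw) with F-orient Fuw
  ... | inj₁ (hu , _) = ¬¬-map (λ (c , ch) → c , u , (w , u<w , Fuw , inj₁ refl) , hu , ch) (chargeable hu Fuw)
  ... | inj₂ (_ , hw) = ¬¬-map (λ (c , ch) → c , w , (w , u<w , Fuw , inj₂ refl) , hw , ch)
                               (chargeable hw (matching-sym isF Fuw))

  charges-apart : ∀ {u u' c c'} → Charges u c → Charges u' c' → u ≢ u' → Apart c c'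
  charges-apart {c = c} {c'} (h , end , hh , ch) (h' , end' , hh' , ch') u≢u' =
      (λ c≡ c'≡ z z∈p z∈q → h≢h' (augmentingCharges-meet hh hh' (as c≡ ch) (as c'≡ ch') z∈p z∈q))
    , (λ c≡ c'≡ → h≢h' ∘ badCharges-injective hh hh' (as c≡ ch) (as c'≡ ch'))
    , (λ c≡ c'≡ → h≢h' ∘ frequentCharges-injective (as c≡ ch) (as c'≡ ch'))
    where
    h≢h' : h ≢ h'
    h≢h' refl = u≢u' (smallerEnd-unique end end')

    as : ∀ {g d e} → d ≡ e → ChargeOf g d → ChargeOf g e
    as = subst (ChargeOf _)

  charges-legit : ∀ {u c} → Charges u c → Legit c
  charges-legit (_ , _ , hh , lowBad Fhl l-matched) = l-matched , low-notOnFrequent (F-partner-low hh Fhl) l-matched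
  charges-legit (_ , _ , _  , highBad isBad)          = isBad
  charges-legit (_ , _ , _  , augmenting aug _ _)     = aug
  charges-legit (_ , _ , _  , frequent _ allowed _ _) = allowed

  -- The bound is decidable, so the charge of each edge may be chosen classically.
  charging-bound : ∀ {a b N} → IsMaxNumDisjointAug (K ∪ₑ F) M a → Covered Bad b → Covered Allowed N →
    size F ≤ a + b + N
  charging-bound {a} {b} {N} isMax badCover allowedCover = decidable-stable (_ ℕ.≤? _) λ size≰ →
    ¬¬-pointwise (All.map lowerEnd-charges allLowerEnds) λ (cs , charged) → size≰ (bound cs charged)
    where
    allLowerEnds : All LowerEnd lowerEnds
    allLowerEnds = all-filter lowerEnd? (allFin n)

    bound : ∀ cs → Pointwise Charges lowerEnds cs → size F ≤ a + b + N
    bound cs charged = begin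
      size F              ≤⟨ size≤length-lowerEnds ⟩
      length lowerEnds    ≡⟨ Pointwise-length charged ⟩
      length cs           ≤⟨ charges-bound isMax badCover allowedCover
                               (AllPairs-pointwise charges-apart charged (Unique.filter⁺ lowerEnd? (Unique.allFin⁺ n)))
                               (All-pointwise (λ ch _ → charges-legit ch) charged allLowerEnds) ⟩
      a + b + N           ∎
      where open ℕ.≤-Reasoning

lemma3p9 : (n d i : ℕ) (G K M M* MH MSH : Graph n) →
  50000000 ≤ d →
  1 ≤ i → i ≤ 50000000 →
  IsGraph G →
  IsKernel ε d G K →
  IsMaximumMatching K M →
  IsMaximumMatching G M* →
  (⟦ 2 ⟧ - δ) * ⟦ size M ⟧ ≤ℚ ⟦ size M* ⟧ →
  ⟦ numUnmatchedIn (Classes.inH d i K) M ⟧ ≤ℚ ⟦ 7 ⟧ * s * ⟦ size M ⟧ →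
  IsApproxMatching β (bip G (Classes.inH d i K) (Classes.inL d i K)) MH →
  IsApproxMatching β (bip G (Classes.inSH d i K) (Classes.inL d i K)) MSH →
  (aH aSH n₁ n₂ n₃ n₄ b : ℕ) →
  IsMaxNumDisjointAug (K ∪ₑ MH) M aH →
  IsMaxNumDisjointAug (K ∪ₑ MSH) M aSH →
  Card (Frequent.FreqPath d i K M M* 1) n₁ →
  Card (Frequent.FreqPath d i K M M* 2) n₂ →
  Card (Frequent.FreqPath d i K M M* 3) n₃ →
  Card (Frequent.FreqPath d i K M M* 4) n₄ →
  Card (Frequent.Bad d i K M M*) b →
  (size MH ≤ aH + b + (n₁ + n₂ + n₃ + n₄)) ×
  (size MSH ≤ aSH + b + (n₁ + n₂))
lemma3p9 n d i G K M M* MH MSH d≥5·10⁷ _ i≤ _ _ (isM , _) (isM* , _) _ _ (isMH , _) (isMSH , _)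
         aH aSH n₁ n₂ n₃ n₄ b maxH maxSH card₁ card₂ card₃ card₄ cardBad =
    ChargingH.charging-bound maxH badCover (covered-⊎ (covered-⊎ (covered-⊎ cover₁ cover₂) cover₃) cover₄)
  , ChargingSH.charging-bound maxSH badCover (covered-⊎ cover₁ cover₂)
  where
  d≥1 = ℕ.≤-trans (s≤s z≤n) d≥5·10⁷
  open Classes d i K
  open Frequent d i K M M* using (OnFrequent)
  open ClassFacts d i K d≥1 i≤
  open FrequentFacts d i K M M* isM d≥1 i≤ using (AnyType; low-notOnFrequent; resolve-H; resolve-SH)

  module ChargingH = Charging G K M M* MH inH inL inM isM isM* isMH H⇒¬L H⇒¬Mid L⇒¬Mid
    OnFrequent low-notOnFrequent AnyType (λ _ Mhm onFreq → inj₁ (resolve-H Mhm onFreq))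
  module ChargingSH = Charging G K M M* MSH inSH inL inM isM isM* isMSH (H⇒¬L ∘ SH⇒H) (H⇒¬Mid ∘ SH⇒H) L⇒¬Mid
    OnFrequent low-notOnFrequent _ resolve-SH

  badCover = card⇒covered cardBad
  cover₁ = card⇒covered card₁
  cover₂ = card⇒covered card₂
  cover₃ = card⇒covered card₃
  cover₄ = card⇒covered card₄
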